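{- For any $m\ge0$, $\left|\mathcal{O}^{ -1}_{\mathrm{MVP}_{m+2}}(\beta_{m,2})\right|=m+1+\left\lfloor\frac{(m+1)^2}{2}\right\rfloor$, where $\beta_{m,2}=3\,4\cdots(m+2)\,1\,2\in S_{m+2}$.
   Context: For $N\ge1$, $[N]=\{1,\dots,N\}$. In the MVP parking process for a preference $p\in[N]^N$, cars $1,\dots,N$ enter in order a one-way street with spots $1,\dots,N$; car $i$ parks in spot $p_i$, and if $p_i$ was occupied by an earlier car $j$, car $j$ is bumped and parks in the first unoccupied spot $k>p_i$ (bumped cars do not bump others). $p$ is an MVP parking function if all cars park. The outcome $\mathcal{O}_{\mathrm{MVP}_N}(p)$ is the permutation $\pi$ with $\pi_i$ the car in spot $i$ at the end, and $\mathcal{O}^{ -1}_{\mathrm{MVP}_N}(\pi)$ is the set of MVP parking functions of length $N$ with outcome $\pi$. For $m,n\ge0$, $\beta_{m,n}=(n+1)(n+2)\cdots(n+m)\,1\,2\cdots n$ (one-line notation); in particular $\beta_{0,2}=12$. -}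

module Defs where

open import Data.Nat using (ℕ; zero; suc; _+_; _≤?_; _≟_)
open import Data.List using (List; []; _∷_; length; filter; map; concatMap; upTo; _++_; replicate)
open import Data.Maybe using (Maybe; just; nothing; _>>=_)
open import Relation.Nullary using (Dec; yes; no)
open import Relation.Binary.PropositionalEquality using (_≡_)
import Data.List.Properties as LP
import Data.Maybe.Properties as MP

-- Spots are 1-indexed; a street state is a list of length N whose k-th entry
-- (counting from 1) is 'just c' if car c occupies spot k, 'nothing' otherwise.
Street : Set
Street = List (Maybe ℕ)

placeFirstFree : ℕ → Street → Maybe Street
placeFirstFree c [] = nothing
placeFirstFree c (nothing ∷ s) = just (just c ∷ s)
placeFirstFree c (just d ∷ s) = Data.Maybe.map (just d ∷_) (placeFirstFree c s)

enter : ℕ → ℕ → Street → Maybe Street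
enter c a [] = nothing
enter c zero s = nothing
enter c (suc zero) (nothing ∷ s) = just (just c ∷ s)
enter c (suc zero) (just j ∷ s) = Data.Maybe.map (just c ∷_) (placeFirstFree j s)
enter c (suc (suc a)) (x ∷ s) = Data.Maybe.map (x ∷_) (enter c (suc a) s)

runFrom : ℕ → List ℕ → Street → Maybe Street
runFrom i [] s = just s
runFrom i (a ∷ p) s = enter i a s >>= runFrom (suc i) p

allParked : Street → Maybe (List ℕ)
allParked [] = just []
allParked (nothing ∷ s) = nothing
allParked (just c ∷ s) = Data.Maybe.map (c ∷_) (allParked s)

-- MVP outcome of a preference list p of length N (cars 1..N, empty street of
-- N spots); 'nothing' iff p is not an MVP parking function.
mvpOutcome : List ℕ → Maybe (List ℕ)
mvpOutcome p = runFrom 1 p (replicate (length p) nothing) >>= allParked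

range1 : ℕ → List ℕ
range1 N = map suc (upTo N)

prefs : ℕ → ℕ → List (List ℕ)
prefs N zero = [] ∷ []
prefs N (suc k) = concatMap (λ a → map (a ∷_) (prefs N k)) (range1 N)

β : ℕ → ℕ → List ℕ
β m n = map (λ i → n + i) (range1 m) ++ range1 n

outcomeIs : List ℕ → List ℕ → Set
outcomeIs π p = mvpOutcome p ≡ just π

outcomeIs? : (π p : List ℕ) → Dec (outcomeIs π p)
outcomeIs? π p = MP.≡-dec (LP.≡-dec _≟_) (mvpOutcome p) (just π)

mvpFiber : ℕ → List ℕ → List (List ℕ)
mvpFiber N π = filter (outcomeIs? π) (prefs N N)

-- The first two cars park at spots a and b (when a = b, car 1 is bumped to
-- a + 1).  To reach the outcome β_{m,2}, car 3 + j must then prefer spot j + 1: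
-- a smaller preference bumps a car 3 + p out of spot p + 1, a larger one leaves
-- car 3 + j itself behind spot j + 1, and cars never move towards the entrance.
-- These forced cars push cars 1 and 2 down the street of N = m + 2 spots, and
-- the one starting in the later spot s ends in spot N exactly when N − s is
-- even.  So every pair (a, b) contributes 0 or 1, and of (a, b) and (b, a),
-- a ≠ b, exactly one contributes: the count is (N choose 2) plus the number
-- ⌊(N − 1)/2⌋ of contributing diagonal pairs, evaluated by a two-step
-- recursion in N.

module Submission where

open import Defs
open import Data.Nat using (ℕ; zero; suc; pred; _+_; _*_; _∸_; _/_; _≤_; _<_; z≤n; s≤s; _≟_; _<?_)
open import Data.Nat.Properties
  using (≤-refl; ≤-trans; <-trans; <-irrefl; <-≤-trans; <⇒≢; <⇒≤; m≤n⇒m<n∨m≡n; <-cmp; +-cancelˡ-≡; m≤m+n; m≤n+m; m<m+n; +-suc; +-identityʳ; n<1+n; +-comm; +-assoc; *-zeroʳ; *-identityʳ)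
open import Data.Bool using (if_then_else_)
open import Data.List using (List; []; _∷_; length; filter; map; concatMap; upTo; take; _++_; replicate; [_])
open import Data.List.Properties
  using (filter-++; filter-none; length-++; length-map; length-upTo; concatMap-map; map-upTo; upTo-∷ʳ; map-++; ++-assoc; ++-cancelˡ)
import Data.List.Relation.Unary.All as All
open import Data.List.Relation.Unary.All.Properties using (++⁺; map⁺; take⁺)
open import Data.List.Relation.Unary.All using (All; []; _∷_)
open import Function using (_∘_)
open import Data.Maybe as Maybe using (Maybe; just; nothing; _>>=_)
open import Data.Maybe.Properties using (just-injective)
import Data.Maybe.Relation.Unary.All as MaybeAll
import Data.List.Properties as LP
import Data.Maybe.Properties as MP
open import Data.Empty using (⊥-elim)
open import Data.Product using (_,_; ∃-syntax)
open import Data.Sum using (inj₁; inj₂)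
open import Relation.Nullary using (Dec; yes; no; does; ¬_)
open import Relation.Nullary.Decidable using (dec-true; dec-false)
open import Relation.Binary.Definitions using (DecidableEquality; tri<; tri≈; tri>)
open import Function.Bundles using (_⇔_; mk⇔; module Equivalence)
open import Relation.Binary.PropositionalEquality using (_≡_; _≢_; refl; sym; trans; cong; cong₂; subst; module ≡-Reasoning)
open import Data.Nat.DivMod using (+-distrib-/-∣ʳ; m*n/n≡m)
open import Data.Nat.Divisibility using (divides)
open import Data.Nat.Tactic.RingSolver using (solve-∀)

-- Sums over [1, n]

∑ : ℕ → (ℕ → ℕ) → ℕ
∑ zero    f = 0
∑ (suc n) f = f 1 + ∑ n (λ a → f (suc a))

∑-cong : ∀ n {f g : ℕ → ℕ} → (∀ a → 1 ≤ a → a ≤ n → f a ≡ g a) → ∑ n f ≡ ∑ n g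
∑-cong zero    f≡g = refl
∑-cong (suc n) f≡g =
  cong₂ _+_ (f≡g 1 ≤-refl (s≤s z≤n)) (∑-cong n (λ a _ a≤n → f≡g (suc a) (s≤s z≤n) (s≤s a≤n)))

∑-const : ∀ n c → ∑ n (λ _ → c) ≡ n * c
∑-const zero    c = refl
∑-const (suc n) c = cong (c +_) (∑-const n c)

∑-+ : ∀ n (f g : ℕ → ℕ) → ∑ n (λ a → f a + g a) ≡ ∑ n f + ∑ n g
∑-+ zero    f g = refl
∑-+ (suc n) f g rewrite ∑-+ n (λ a → f (suc a)) (λ a → g (suc a)) =
  interchange (f 1) (g 1) (∑ n (λ a → f (suc a))) (∑ n (λ a → g (suc a)))
  where
  interchange : ∀ w x y z → (w + x) + (y + z) ≡ (w + y) + (x + z)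
  interchange = solve-∀

∑-δ : ∀ n {f : ℕ → ℕ} a₀ → 1 ≤ a₀ → a₀ ≤ n → (∀ a → 1 ≤ a → a ≤ n → a ≢ a₀ → f a ≡ 0) → ∑ n f ≡ f a₀
∑-δ (suc n) {f} (suc zero) _ _ f≡0 = begin
  f 1 + ∑ n (λ a → f (suc a))  ≡⟨ cong (f 1 +_) (∑-cong n λ a 1≤a a≤n → f≡0 (suc a) (s≤s z≤n) (s≤s a≤n) (1≢suc 1≤a)) ⟩
  f 1 + ∑ n (λ _ → 0)          ≡⟨ cong (f 1 +_) (trans (∑-const n 0) (*-zeroʳ n)) ⟩
  f 1 + 0                      ≡⟨ +-comm (f 1) 0 ⟩
  f 1                          ∎
  where
  open ≡-Reasoning
  1≢suc : ∀ {a} → 1 ≤ a → suc a ≢ 1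
  1≢suc (s≤s _) ()
∑-δ (suc n) {f} (suc (suc a₀)) _ (s≤s a₀<n) f≡0 =
  cong₂ _+_ (f≡0 1 ≤-refl (s≤s z≤n) (λ ()))
            (∑-δ n (suc a₀) (s≤s z≤n) a₀<n (λ a 1≤a a≤n a≢ → f≡0 (suc a) (s≤s z≤n) (s≤s a≤n) (λ e → a≢ (cong pred e))))

∑∑-peel : ∀ n (f : ℕ → ℕ → ℕ) →
  ∑ (suc n) (λ a → ∑ (suc n) (f a))
    ≡ f 1 1 + ∑ n (λ b → f 1 (suc b) + f (suc b) 1) + ∑ n (λ a → ∑ n (λ b → f (suc a) (suc b)))
∑∑-peel n f = begin
  (f 1 1 + ∑ n (λ b → f 1 (suc b))) + ∑ n (λ a → f (suc a) 1 + ∑ n (λ b → f (suc a) (suc b)))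
    ≡⟨ cong ((f 1 1 + ∑ n (λ b → f 1 (suc b))) +_) (∑-+ n (λ a → f (suc a) 1) (λ a → ∑ n (λ b → f (suc a) (suc b)))) ⟩
  (f 1 1 + R) + (C + D)
    ≡⟨ regroup (f 1 1) R C D ⟩
  f 1 1 + (R + C) + D
    ≡⟨ cong (λ x → f 1 1 + x + D) (sym (∑-+ n (λ b → f 1 (suc b)) (λ b → f (suc b) 1))) ⟩
  f 1 1 + ∑ n (λ b → f 1 (suc b) + f (suc b) 1) + D
    ∎
  where
  open ≡-Reasoning
  R = ∑ n (λ b → f 1 (suc b))
  C = ∑ n (λ a → f (suc a) 1)
  D = ∑ n (λ a → ∑ n (λ b → f (suc a) (suc b)))
  regroup : ∀ w x y z → (w + x) + (y + z) ≡ w + (x + y) + z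
  regroup = solve-∀

range1-suc : ∀ n → range1 (suc n) ≡ 1 ∷ map suc (range1 n)
range1-suc n = cong (λ xs → 1 ∷ map suc xs) (sym (map-upTo suc n))

_≟ᴹ_ : DecidableEquality (Maybe (List ℕ))
_≟ᴹ_ = MP.≡-dec (LP.≡-dec _≟_)

𝟙 : {P : Set} → Dec P → ℕ
𝟙 (yes _) = 1
𝟙 (no _)  = 0

𝟙-⇔ : ∀ {P Q : Set} → P ⇔ Q → (p : Dec P) (q : Dec Q) → 𝟙 p ≡ 𝟙 q
𝟙-⇔ _   (yes _) (yes _) = refl
𝟙-⇔ P⇔Q (yes p) (no ¬q) = ⊥-elim (¬q (Equivalence.to P⇔Q p))
𝟙-⇔ P⇔Q (no ¬p) (yes q) = ⊥-elim (¬p (Equivalence.from P⇔Q q))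
𝟙-⇔ _   (no _)  (no _)  = refl

count : (List ℕ → Maybe (List ℕ)) → Maybe (List ℕ) → List (List ℕ) → ℕ
count f y xs = length (filter (λ x → f x ≟ᴹ y) xs)

count-[] : ∀ f y → count f y ([] ∷ []) ≡ 𝟙 (f [] ≟ᴹ y)
count-[] f y with f [] ≟ᴹ y
... | yes _ = refl
... | no _  = refl

count-∷ : ∀ f y x xs → count f y (x ∷ xs) ≡ 𝟙 (f x ≟ᴹ y) + count f y xs
count-∷ f y x xs with f x ≟ᴹ y
... | yes _ = refl
... | no _  = refl

count-++ : ∀ f y xs ys → count f y (xs ++ ys) ≡ count f y xs + count f y ys
count-++ f y xs ys = trans (cong length (filter-++ (λ x → f x ≟ᴹ y) xs ys)) (length-++ (filter _ xs))

count-congᴬ : ∀ {f g} y {xs} → All (λ x → f x ≡ g x) xs → count f y xs ≡ count g y xs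
count-congᴬ y []                     = refl
count-congᴬ {f} {g} y {x ∷ xs} (e ∷ es) = begin
  count f y (x ∷ xs)              ≡⟨ count-∷ f y x xs ⟩
  𝟙 (f x ≟ᴹ y) + count f y xs     ≡⟨ cong₂ _+_ (cong (λ z → 𝟙 (z ≟ᴹ y)) e) (count-congᴬ y es) ⟩
  𝟙 (g x ≟ᴹ y) + count g y xs     ≡⟨ count-∷ g y x xs ⟨
  count g y (x ∷ xs)              ∎
  where open ≡-Reasoning

count-none : ∀ f y xs → (∀ x → f x ≢ y) → count f y xs ≡ 0
count-none f y xs f≢y = cong length (filter-none (λ x → f x ≟ᴹ y) {xs} (All.tabulate (λ {x} _ → f≢y x)))

count-map-∷ : ∀ f y a ys → count f y (map (a ∷_) ys) ≡ count (λ t → f (a ∷ t)) y ys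
count-map-∷ f y a []       = refl
count-map-∷ f y a (t ∷ ts) = begin
  count f y (map (a ∷_) (t ∷ ts))                        ≡⟨ count-∷ f y (a ∷ t) _ ⟩
  𝟙 (f (a ∷ t) ≟ᴹ y) + count f y (map (a ∷_) ts)         ≡⟨ cong (𝟙 (f (a ∷ t) ≟ᴹ y) +_) (count-map-∷ f y a ts) ⟩
  𝟙 (f (a ∷ t) ≟ᴹ y) + count (λ t → f (a ∷ t)) y ts      ≡⟨ count-∷ (λ t → f (a ∷ t)) y t ts ⟨
  count (λ t → f (a ∷ t)) y (t ∷ ts)                     ∎
  where open ≡-Reasoning

count-concatMap-range1 : ∀ f y n (g : ℕ → List (List ℕ)) → count f y (concatMap g (range1 n)) ≡ ∑ n (λ a → count f y (g a))
count-concatMap-range1 f y zero    g = refl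
count-concatMap-range1 f y (suc n) g = begin
  count f y (concatMap g (range1 (suc n)))                ≡⟨ cong (count f y ∘ concatMap g) (range1-suc n) ⟩
  count f y (g 1 ++ concatMap g (map suc (range1 n)))     ≡⟨ count-++ f y (g 1) _ ⟩
  count f y (g 1) + count f y (concatMap g (map suc (range1 n)))
    ≡⟨ cong (λ xs → count f y (g 1) + count f y xs) (concatMap-map g suc (range1 n)) ⟩
  count f y (g 1) + count f y (concatMap (g ∘ suc) (range1 n))
    ≡⟨ cong (count f y (g 1) +_) (count-concatMap-range1 f y n (g ∘ suc)) ⟩
  ∑ (suc n) (λ a → count f y (g a))                       ∎
  where open ≡-Reasoning

count-prefs-suc : ∀ f y N k → count f y (prefs N (suc k)) ≡ ∑ N (λ a → count (λ t → f (a ∷ t)) y (prefs N k))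
count-prefs-suc f y N k =
  trans (count-concatMap-range1 f y N (λ a → map (a ∷_) (prefs N k)))
        (∑-cong N (λ a _ _ → count-map-∷ f y a (prefs N k)))

prefs-length : ∀ N k → All (λ t → length t ≡ k) (prefs N k)
prefs-length N zero    = refl ∷ []
prefs-length N (suc k) = go (range1 N)
  where
  go : ∀ as → All (λ t → length t ≡ suc k) (concatMap (λ a → map (a ∷_) (prefs N k)) as)
  go []       = []
  go (a ∷ as) = ++⁺ (map⁺ (All.map (cong suc) (prefs-length N k))) (go as)

just-≢ : ∀ {d c : ℕ} → d ≢ c → just d ≢ just c
just-≢ d≢c e = d≢c (just-injective e)

allParked-prefix : ∀ xs R → allParked (map just xs ++ R) ≡ Maybe.map (xs ++_) (allParked R)
allParked-prefix []       R with allParked R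
... | nothing = refl
... | just _  = refl
allParked-prefix (x ∷ xs) R rewrite allParked-prefix xs R with allParked R
... | nothing = refl
... | just _  = refl

allParked-just : ∀ s {l} → allParked s ≡ just l → s ≡ map just l
allParked-just []            refl = refl
allParked-just (just c ∷ s) eq with allParked s in eq′ | eq
... | just _ | refl = cong (just c ∷_) (allParked-just s eq′)

-- The car entering next parks in the first spot of R; a car found there is
-- bumped to the first free spot of the rest, and the rest is returned.
pop : Street → Maybe Street
pop []            = nothing
pop (nothing ∷ r) = just r
pop (just c ∷ r)  = placeFirstFree c r

enter-prefix : ∀ d xs R → enter d (suc (length xs)) (map just xs ++ R) ≡ Maybe.map (λ R′ → map just xs ++ just d ∷ R′) (pop R)
enter-prefix d []       []            = refl
enter-prefix d []       (nothing ∷ R) = refl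
enter-prefix d []       (just _ ∷ R)  = refl
enter-prefix d (x ∷ xs) R rewrite enter-prefix d xs R with pop R
... | nothing = refl
... | just _  = refl

settle : ℕ → Street → Maybe Street
settle zero    R = just R
settle (suc k) R = pop R >>= settle k

endsIn12 : ℕ → Street → ℕ
endsIn12 k R = 𝟙 ((settle k R >>= allParked) ≟ᴹ just (1 ∷ 2 ∷ []))

-- Cars never move backwards

Avoids : ℕ → ℕ → Street → Set
Avoids c q s = All (_≢ just c) (take q s)

placeFirstFree-avoids : ∀ {e c} q r {r′} → placeFirstFree e r ≡ just r′ → e ≢ c → Avoids c q r → Avoids c q r′
placeFirstFree-avoids zero    r                 _    _   _          = []
placeFirstFree-avoids (suc q) (nothing ∷ r)     refl e≢c (_ ∷ av)   = just-≢ e≢c ∷ av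
placeFirstFree-avoids {e} (suc q) (just d ∷ r) eq e≢c (d≢c ∷ av) with placeFirstFree e r in eq′ | eq
... | just r₁ | refl = d≢c ∷ placeFirstFree-avoids q r eq′ e≢c av

enter-avoids : ∀ {d c} a q s {s′} → enter d a s ≡ just s′ → d ≢ c → Avoids c q s → Avoids c q s′
enter-avoids a zero s _ _ _ = []
enter-avoids (suc zero) (suc q) (nothing ∷ r) refl d≢c (_ ∷ av) = just-≢ d≢c ∷ av
enter-avoids {d} (suc zero) (suc q) (just e ∷ r) eq d≢c (e≢c ∷ av) with placeFirstFree e r in eq′ | eq
... | just r₁ | refl = just-≢ d≢c ∷ placeFirstFree-avoids q r eq′ (e≢c ∘ cong just) av
enter-avoids {d} (suc (suc a)) (suc q) (x ∷ r) eq d≢c (x≢c ∷ av) with enter d (suc a) r in eq′ | eq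
... | just r₁ | refl = x≢c ∷ enter-avoids (suc a) q r eq′ d≢c av

enter-avoids-before : ∀ {d c} a s {s′} → enter d (suc a) s ≡ just s′ → Avoids c a s → Avoids c a s′
enter-avoids-before zero s _ _ = []
enter-avoids-before {d} (suc a) (x ∷ r) eq (x≢c ∷ av) with enter d (suc a) r in eq′ | eq
... | just r₁ | refl = x≢c ∷ enter-avoids-before a r eq′ av

enter-avoids-through : ∀ {d c} a s {s′} → enter d (suc a) s ≡ just s′ → d ≢ c → Avoids c a s → Avoids c (suc a) s′
enter-avoids-through zero (nothing ∷ r) refl d≢c _ = just-≢ d≢c ∷ []
enter-avoids-through {d} zero (just e ∷ r) eq d≢c _ with placeFirstFree e r | eq
... | just r₁ | refl = just-≢ d≢c ∷ []
enter-avoids-through {d} (suc a) (x ∷ r) eq d≢c (x≢c ∷ av) with enter d (suc a) r in eq′ | eq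
... | just r₁ | refl = x≢c ∷ enter-avoids-through a r eq′ d≢c av

runFrom-avoids : ∀ {c q} i t s {s′} → runFrom i t s ≡ just s′ → c < i → Avoids c q s → Avoids c q s′
runFrom-avoids i [] s refl _ av = av
runFrom-avoids {q = q} i (a ∷ t) s eq c<i av with enter i a s in eq′
... | just s₁ = runFrom-avoids (suc i) t s₁ eq (<-trans c<i (n<1+n i)) (enter-avoids a q s eq′ (λ { refl → <-irrefl refl c<i }) av)

Avoids-prefix : ∀ {c} xs r → All (_≢ c) xs → Avoids c (length xs) (map just xs ++ r)
Avoids-prefix []       r []           = []
Avoids-prefix (x ∷ xs) r (x≢c ∷ xs≢c) = just-≢ x≢c ∷ Avoids-prefix xs r xs≢c

Avoids-hit : ∀ {c} xs ys q → length xs < q → ¬ Avoids c q (map just xs ++ just c ∷ ys)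
Avoids-hit []       ys (suc q) _         (c≢c ∷ _) = c≢c refl
Avoids-hit (x ∷ xs) ys (suc q) (s≤s <q)  (_ ∷ av)  = Avoids-hit xs ys q <q av

AllBelow : ℕ → Street → Set
AllBelow d = All (MaybeAll.All (_< d))

AllBelow⇒Avoids : ∀ {c} q {s} → AllBelow c s → Avoids c q s
AllBelow⇒Avoids {c} q below = take⁺ q (All.map absent below)
  where
  absent : ∀ {x} → MaybeAll.All (_< c) x → x ≢ just c
  absent (MaybeAll.just x<c) refl = <-irrefl refl x<c

AllBelow-mono : ∀ {d d′ s} → d ≤ d′ → AllBelow d s → AllBelow d′ s
AllBelow-mono d≤d′ = All.map (MaybeAll.map (λ x<d → <-≤-trans x<d d≤d′))

placeFirstFree-allBelow : ∀ {d e} r {r′} → placeFirstFree e r ≡ just r′ → e < d → AllBelow d r → AllBelow d r′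
placeFirstFree-allBelow (nothing ∷ r) refl e<d (_ ∷ below) = MaybeAll.just e<d ∷ below
placeFirstFree-allBelow {e = e} (just x ∷ r) eq e<d (x<d ∷ below) with placeFirstFree e r in eq′ | eq
... | just r₁ | refl = x<d ∷ placeFirstFree-allBelow r eq′ e<d below

pop-allBelow : ∀ {d} R {R′} → pop R ≡ just R′ → AllBelow d R → AllBelow d R′
pop-allBelow (nothing ∷ r) refl (_ ∷ below)      = below
pop-allBelow (just c ∷ r)  eq   (MaybeAll.just c<d ∷ below) = placeFirstFree-allBelow r eq c<d below

-- carAt x y is the content of a spot lying x spots before car 1 and y spots
-- before car 2, where the distance 0 means the car is absent.
carAt : ℕ → ℕ → Maybe ℕ
carAt 1 _ = just 1
carAt _ 1 = just 2
carAt _ _ = nothing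

twoCars : ℕ → ℕ → ℕ → Street
twoCars zero    x y = []
twoCars (suc L) x y = carAt x y ∷ twoCars L (pred x) (pred y)

twoCars-empty : ∀ L → twoCars L 0 0 ≡ replicate L nothing
twoCars-empty zero    = refl
twoCars-empty (suc L) = cong (nothing ∷_) (twoCars-empty L)

twoCars-allBelow : ∀ L x y → AllBelow 3 (twoCars L x y)
twoCars-allBelow zero    x y = []
twoCars-allBelow (suc L) x y = carAt-below x y ∷ twoCars-allBelow L (pred x) (pred y)
  where
  carAt-below : ∀ x y → MaybeAll.All (_< 3) (carAt x y)
  carAt-below 1             _ = MaybeAll.just (s≤s (s≤s z≤n))
  carAt-below 0             1 = MaybeAll.just (s≤s (s≤s (s≤s z≤n)))
  carAt-below (suc (suc _)) 1 = MaybeAll.just (s≤s (s≤s (s≤s z≤n)))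
  carAt-below 0             0 = MaybeAll.nothing
  carAt-below 0             (suc (suc _)) = MaybeAll.nothing
  carAt-below (suc (suc _)) 0 = MaybeAll.nothing
  carAt-below (suc (suc _)) (suc (suc _)) = MaybeAll.nothing

enter-first : ∀ N a → 1 ≤ a → a ≤ N → enter 1 a (replicate N nothing) ≡ just (twoCars N a 0)
enter-first (suc N) 1             _ _         = cong (λ r → just (just 1 ∷ r)) (sym (twoCars-empty N))
enter-first (suc N) (suc (suc a)) _ (s≤s a<N) rewrite enter-first N (suc a) (s≤s z≤n) a<N = refl

enter-second : ∀ N a b → 1 ≤ b → b ≤ N → a ≢ b → enter 2 b (twoCars N a 0) ≡ just (twoCars N a b)
enter-second (suc N) 0             1             _ _ _   = refl
enter-second (suc N) 1             1             _ _ a≢b = ⊥-elim (a≢b refl)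
enter-second (suc N) (suc (suc a)) 1             _ _ _   = refl
enter-second (suc N) 0             (suc (suc b)) _ (s≤s b<N) _
  rewrite enter-second N 0 (suc b) (s≤s z≤n) b<N (λ ()) = refl
enter-second (suc N) 1             (suc (suc b)) _ (s≤s b<N) _
  rewrite enter-second N 0 (suc b) (s≤s z≤n) b<N (λ ()) = refl
enter-second (suc N) (suc (suc a)) (suc (suc b)) _ (s≤s b<N) a≢b
  rewrite enter-second N (suc a) (suc b) (s≤s z≤n) b<N (a≢b ∘ cong suc) = refl

enter-second-bumps : ∀ N a → 1 ≤ a → a < N → enter 2 a (twoCars N a 0) ≡ just (twoCars N (suc a) a)
enter-second-bumps (suc (suc N)) 1             _ _         = refl
enter-second-bumps (suc N)       (suc (suc a)) _ (s≤s a<N) rewrite enter-second-bumps N (suc a) (s≤s z≤n) a<N = refl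

enter-second-bumps-last : ∀ N → 1 ≤ N → enter 2 N (twoCars N N 0) ≡ nothing
enter-second-bumps-last 1             _ = refl
enter-second-bumps-last (suc (suc N)) _ rewrite enter-second-bumps-last (suc N) (s≤s z≤n) = refl

isEven : ℕ → ℕ
isEven 0             = 1
isEven 1             = 0
isEven (suc (suc n)) = isEven n

isOdd : ℕ → ℕ
isOdd n = isEven (suc n)

isEven+isOdd : ∀ n → isEven n + isOdd n ≡ 1
isEven+isOdd 0             = refl
isEven+isOdd 1             = refl
isEven+isOdd (suc (suc n)) = isEven+isOdd n

-- The car in the later spot ends in the last spot L exactly when L minus its spot is even.
orderValue : ℕ → ℕ → ℕ → ℕ
orderValue L x y = if does (x <? y) then isEven (L ∸ y) else isOdd (L ∸ x)

endsIn12-twoCars : ∀ m x y → 1 ≤ x → x ≤ 2 + m → 1 ≤ y → y ≤ 2 + m → x ≢ y →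
                   endsIn12 m (twoCars (2 + m) x y) ≡ orderValue (2 + m) x y
endsIn12-twoCars zero 1 1 _ _ _ _ x≢y = ⊥-elim (x≢y refl)
endsIn12-twoCars zero 1 2 _ _ _ _ _   = refl
endsIn12-twoCars zero 2 1 _ _ _ _ _   = refl
endsIn12-twoCars zero 2 2 _ _ _ _ x≢y = ⊥-elim (x≢y refl)
endsIn12-twoCars zero 1 (suc (suc (suc y))) _ _ _ (s≤s (s≤s ())) _
endsIn12-twoCars zero 2 (suc (suc (suc y))) _ _ _ (s≤s (s≤s ())) _
endsIn12-twoCars zero (suc (suc (suc x))) y _ (s≤s (s≤s ())) _ _ _
endsIn12-twoCars (suc m) 1 1 _ _ _ _ x≢y = ⊥-elim (x≢y refl)
endsIn12-twoCars (suc m) 1 2 _ _ _ _ _ =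
  endsIn12-twoCars m 2 1 (s≤s z≤n) (s≤s (s≤s z≤n)) (s≤s z≤n) (s≤s z≤n) (λ ())
endsIn12-twoCars (suc m) 2 1 _ _ _ _ _ =
  endsIn12-twoCars m 1 2 (s≤s z≤n) (s≤s z≤n) (s≤s z≤n) (s≤s (s≤s z≤n)) (λ ())
endsIn12-twoCars (suc m) 1 (suc (suc (suc y))) _ _ _ (s≤s y≤) _ =
  endsIn12-twoCars m 1 (suc (suc y)) (s≤s z≤n) (s≤s z≤n) (s≤s z≤n) y≤ (λ ())
endsIn12-twoCars (suc m) (suc (suc (suc x))) 1 _ (s≤s x≤) _ _ _ =
  endsIn12-twoCars m (suc (suc x)) 1 (s≤s z≤n) x≤ (s≤s z≤n) (s≤s z≤n) (λ ())
endsIn12-twoCars (suc m) (suc (suc x)) (suc (suc y)) _ (s≤s x≤) _ (s≤s y≤) x≢y =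
  endsIn12-twoCars m (suc x) (suc y) (s≤s z≤n) x≤ (s≤s z≤n) y≤ (x≢y ∘ cong suc)

-- The number of fiber elements in which cars 1 and 2 prefer spots a and b;
-- when a = b, car 1 is bumped to spot a + 1, which needs a < L.
fiberAt : ℕ → ℕ → ℕ → ℕ
fiberAt L a b = if does (a ≟ b) then (if does (a <? L) then orderValue L (suc a) a else 0) else orderValue L a b

lateCars : ℕ → List ℕ
lateCars j = map (2 +_) (range1 j)

lateCars-snoc : ∀ j → lateCars (suc j) ≡ lateCars j ++ [ 3 + j ]
lateCars-snoc j = begin
  map (2 +_) (map suc (upTo (suc j)))        ≡⟨ cong (map (2 +_) ∘ map suc) (upTo-∷ʳ j) ⟨
  map (2 +_) (map suc (upTo j ++ [ j ]))     ≡⟨ cong (map (2 +_)) (map-++ suc (upTo j) [ j ]) ⟩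
  map (2 +_) (range1 j ++ [ suc j ])         ≡⟨ map-++ (2 +_) (range1 j) [ suc j ] ⟩
  lateCars j ++ [ 3 + j ]                    ∎
  where open ≡-Reasoning

lateCars-length : ∀ j → length (lateCars j) ≡ j
lateCars-length j = trans (length-map (2 +_) (range1 j)) (trans (length-map suc (upTo j)) (length-upTo j))

lateCars-below : ∀ j → All (_< 3 + j) (lateCars j)
lateCars-below zero    = []
lateCars-below (suc j) rewrite lateCars-snoc j =
  ++⁺ (All.map (λ x< → <-trans x< (n<1+n (3 + j))) (lateCars-below j)) (n<1+n (3 + j) ∷ [])

lateCars-split : ∀ p j → p < j → ∃[ rest ] lateCars j ≡ lateCars p ++ (3 + p) ∷ rest
lateCars-split p (suc j) (s≤s p≤j) with m≤n⇒m<n∨m≡n p≤j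
... | inj₂ refl = [] , lateCars-snoc p
... | inj₁ p<j with lateCars-split p j p<j
...   | rest , eq = rest ++ [ 3 + j ] , (begin
  lateCars (suc j)                                  ≡⟨ lateCars-snoc j ⟩
  lateCars j ++ [ 3 + j ]                           ≡⟨ cong (_++ [ 3 + j ]) eq ⟩
  (lateCars p ++ (3 + p) ∷ rest) ++ [ 3 + j ]       ≡⟨ ++-assoc (lateCars p) ((3 + p) ∷ rest) [ 3 + j ] ⟩
  lateCars p ++ (3 + p) ∷ rest ++ [ 3 + j ]         ∎)
  where open ≡-Reasoning

lateCars-street : ∀ j R → map just (lateCars j) ++ just (3 + j) ∷ R ≡ map just (lateCars (suc j)) ++ R
lateCars-street j R = begin
  map just (lateCars j) ++ just (3 + j) ∷ R             ≡⟨ ++-assoc (map just (lateCars j)) [ just (3 + j) ] R ⟨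
  (map just (lateCars j) ++ [ just (3 + j) ]) ++ R      ≡⟨ cong (_++ R) (map-++ just (lateCars j) [ 3 + j ]) ⟨
  map just (lateCars j ++ [ 3 + j ]) ++ R               ≡⟨ cong (λ xs → map just xs ++ R) (lateCars-snoc j) ⟨
  map just (lateCars (suc j)) ++ R                      ∎
  where open ≡-Reasoning

enter-lateCars : ∀ j R → enter (3 + j) (suc j) (map just (lateCars j) ++ R) ≡ Maybe.map (map just (lateCars (suc j)) ++_) (pop R)
enter-lateCars j R
  rewrite sym (cong (λ n → enter (3 + j) (suc n) (map just (lateCars j) ++ R)) (lateCars-length j))
        | enter-prefix (3 + j) (lateCars j) R
  with pop R
... | nothing = refl
... | just R′ = cong just (lateCars-street j R′)

Avoids-lateCars : ∀ p j R → p < j → Avoids (3 + p) p (map just (lateCars j) ++ R)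
Avoids-lateCars p j R p<j with lateCars-split p j p<j
... | rest , eq = subst (Avoids (3 + p) p) (sym shape)
  (subst (λ q → Avoids (3 + p) q (map just (lateCars p) ++ tail)) (lateCars-length p)
    (Avoids-prefix (lateCars p) tail (All.map (λ x< → <⇒≢ x<) (lateCars-below p))))
  where
  open ≡-Reasoning
  tail = map just ((3 + p) ∷ rest) ++ R
  shape : map just (lateCars j) ++ R ≡ map just (lateCars p) ++ tail
  shape = begin
    map just (lateCars j) ++ R                                ≡⟨ cong (λ xs → map just xs ++ R) eq ⟩
    map just (lateCars p ++ (3 + p) ∷ rest) ++ R              ≡⟨ cong (_++ R) (map-++ just (lateCars p) _) ⟩
    (map just (lateCars p) ++ map just ((3 + p) ∷ rest)) ++ R ≡⟨ ++-assoc (map just (lateCars p)) _ R ⟩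
    map just (lateCars p) ++ (map just ((3 + p) ∷ rest) ++ R) ∎

β-lateCar : ∀ {m} p q → p < m → p < q → ¬ Avoids (3 + p) q (map just (β m 2))
β-lateCar {m} p q p<m p<q av with lateCars-split p m p<m
... | rest , eq = Avoids-hit (lateCars p) (map just (rest ++ 1 ∷ 2 ∷ [])) q
  (subst (_< q) (sym (lateCars-length p)) p<q) (subst (Avoids (3 + p) q) shape av)
  where
  open ≡-Reasoning
  shape : map just (β m 2) ≡ map just (lateCars p) ++ just (3 + p) ∷ map just (rest ++ 1 ∷ 2 ∷ [])
  shape = begin
    map just (lateCars m ++ 1 ∷ 2 ∷ [])                  ≡⟨ cong (λ xs → map just (xs ++ 1 ∷ 2 ∷ [])) eq ⟩
    map just ((lateCars p ++ (3 + p) ∷ rest) ++ 1 ∷ 2 ∷ []) ≡⟨ cong (map just) (++-assoc (lateCars p) _ _) ⟩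
    map just (lateCars p ++ (3 + p) ∷ rest ++ 1 ∷ 2 ∷ [])   ≡⟨ map-++ just (lateCars p) _ ⟩
    map just (lateCars p) ++ just (3 + p) ∷ map just (rest ++ 1 ∷ 2 ∷ []) ∎

-- The fiber as a double sum

module Completions (N : ℕ) (π : List ℕ) where

  outcomeFrom : ℕ → Street → List ℕ → Maybe (List ℕ)
  outcomeFrom i s t = runFrom i t s >>= allParked

  completions : ℕ → ℕ → Street → ℕ
  completions i k s = count (outcomeFrom i s) (just π) (prefs N k)

  completions? : ℕ → ℕ → Maybe Street → ℕ
  completions? i k nothing  = 0
  completions? i k (just s) = completions i k s

  completions-suc : ∀ i k s → completions i (suc k) s ≡ ∑ N (λ a → completions? (suc i) k (enter i a s))
  completions-suc i k s =
    trans (count-prefs-suc (outcomeFrom i s) (just π) N k) (∑-cong N (λ a _ _ → entering a))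
    where
    entering : ∀ a → count (λ t → outcomeFrom i s (a ∷ t)) (just π) (prefs N k) ≡ completions? (suc i) k (enter i a s)
    entering a with enter i a s
    ... | nothing = count-none _ _ (prefs N k) (λ _ ())
    ... | just _  = refl

  mvpFiber-completions : length (mvpFiber N π) ≡ completions 1 N (replicate N nothing)
  mvpFiber-completions =
    count-congᴬ (just π) (All.map (λ {t} len → cong (λ n → outcomeFrom 1 (replicate n nothing) t) len) (prefs-length N N))

module FiberOfβ (m : ℕ) where

  open Completions (2 + m) (β m 2)

  N : ℕ
  N = 2 + m

  unreachable : ∀ p q i s t → p < m → p < q → 3 + p < i → Avoids (3 + p) q s → outcomeFrom i s t ≢ just (β m 2)
  unreachable p q i s t p<m p<q p<i av e with runFrom i t s in run | e
  ... | just s′ | parked =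
    β-lateCar p q p<m p<q (subst (Avoids (3 + p) q) (allParked-just s′ parked) (runFrom-avoids i t s run p<i av))

  completions-misplaced : ∀ j k R a → j < m → AllBelow 3 R → 1 ≤ a → a ≢ suc j →
    completions? (4 + j) k (enter (3 + j) a (map just (lateCars j) ++ R)) ≡ 0
  completions-misplaced j k R (suc a) j<m below _ a≢ with enter (3 + j) (suc a) (map just (lateCars j) ++ R) in eq
  ... | nothing = refl
  ... | just s₁ with <-cmp a j
  ...   | tri≈ _ refl _ = ⊥-elim (a≢ refl)
  ...   | tri< a<j _ _  = count-none _ _ (prefs N k) λ t →
          unreachable a (suc a) (4 + j) s₁ t (<-trans a<j j<m) (n<1+n a) (s≤s (s≤s (s≤s (s≤s (<⇒≤ a<j)))))
            (enter-avoids-through a _ eq (λ e → <-irrefl (sym (+-cancelˡ-≡ 3 _ _ e)) a<j) (Avoids-lateCars a j R a<j))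
  ...   | tri> _ _ j<a  = count-none _ _ (prefs N k) λ t →
          unreachable j a (4 + j) s₁ t j<m j<a (n<1+n (3 + j))
            (enter-avoids-before a _ eq (AllBelow⇒Avoids a prefix-below))
    where
    prefix-below : AllBelow (3 + j) (map just (lateCars j) ++ R)
    prefix-below = ++⁺ (map⁺ (All.map MaybeAll.just (lateCars-below j))) (AllBelow-mono (m≤m+n 3 j) below)

  completions-forced : ∀ k j R → j + k ≡ m → AllBelow 3 R →
    completions (3 + j) k (map just (lateCars j) ++ R) ≡ endsIn12 k R
  completions-forced zero j R j+0≡m _ with trans (sym (+-identityʳ j)) j+0≡m
  ... | refl = begin
    completions (3 + m) 0 (map just (lateCars m) ++ R)
      ≡⟨ count-[] (outcomeFrom (3 + m) (map just (lateCars m) ++ R)) (just (β m 2)) ⟩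
    𝟙 (allParked (map just (lateCars m) ++ R) ≟ᴹ just (β m 2))
      ≡⟨ cong (λ x → 𝟙 (x ≟ᴹ just (β m 2))) (allParked-prefix (lateCars m) R) ⟩
    𝟙 (Maybe.map (lateCars m ++_) (allParked R) ≟ᴹ just (lateCars m ++ 1 ∷ 2 ∷ []))
      ≡⟨ 𝟙-⇔ (mk⇔ (MP.map-injective (++-cancelˡ (lateCars m) _ _)) (cong (Maybe.map (lateCars m ++_)))) _ _ ⟩
    endsIn12 0 R
      ∎
    where open ≡-Reasoning
  completions-forced (suc k) j R j+k≡m below = begin
    completions (3 + j) (suc k) (map just (lateCars j) ++ R)
      ≡⟨ completions-suc (3 + j) k _ ⟩
    ∑ N (λ a → completions? (4 + j) k (enter (3 + j) a (map just (lateCars j) ++ R)))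
      ≡⟨ ∑-δ N (suc j) (s≤s z≤n) (≤-trans j<m (m≤n+m m 2)) (λ a 1≤a _ → completions-misplaced j k R a j<m below 1≤a) ⟩
    completions? (4 + j) k (enter (3 + j) (suc j) (map just (lateCars j) ++ R))
      ≡⟨ cong (completions? (4 + j) k) (enter-lateCars j R) ⟩
    completions? (4 + j) k (Maybe.map (map just (lateCars (suc j)) ++_) (pop R))
      ≡⟨ popped ⟩
    endsIn12 (suc k) R
      ∎
    where
    open ≡-Reasoning
    j<m : j < m
    j<m = subst (j <_) j+k≡m (m<m+n j (s≤s z≤n))
    popped : completions? (4 + j) k (Maybe.map (map just (lateCars (suc j)) ++_) (pop R)) ≡ endsIn12 (suc k) R
    popped with pop R in eq
    ... | nothing = refl
    ... | just R′ = completions-forced k (suc j) R′ (trans (sym (+-suc j k)) j+k≡m) (pop-allBelow R eq below)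

  completions-twoCars : ∀ x y → 1 ≤ x → x ≤ N → 1 ≤ y → y ≤ N → x ≢ y → completions 3 m (twoCars N x y) ≡ orderValue N x y
  completions-twoCars x y 1≤x x≤N 1≤y y≤N x≢y =
    trans (completions-forced m 0 (twoCars N x y) refl (twoCars-allBelow N x y))
          (endsIn12-twoCars m x y 1≤x x≤N 1≤y y≤N x≢y)

  completions-second : ∀ a b → 1 ≤ a → a ≤ N → 1 ≤ b → b ≤ N → completions? 3 m (enter 2 b (twoCars N a 0)) ≡ fiberAt N a b
  completions-second a b 1≤a a≤N 1≤b b≤N with a ≟ b
  ... | no a≢b rewrite enter-second N a b 1≤b b≤N a≢b | dec-false (a ≟ b) a≢b = completions-twoCars a b 1≤a a≤N 1≤b b≤N a≢b
  ... | yes refl rewrite dec-true (a ≟ a) refl with m≤n⇒m<n∨m≡n a≤N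
  ...   | inj₁ a<N rewrite enter-second-bumps N a 1≤a a<N | dec-true (a <? N) a<N =
          completions-twoCars (suc a) a (s≤s z≤n) a<N 1≤a a≤N (λ e → <-irrefl (sym e) (n<1+n a))
  ...   | inj₂ refl rewrite enter-second-bumps-last N 1≤a | dec-false (N <? N) (<-irrefl refl) = refl

  completions-first : ∀ a → 1 ≤ a → a ≤ N → completions 2 (suc m) (twoCars N a 0) ≡ ∑ N (fiberAt N a)
  completions-first a 1≤a a≤N =
    trans (completions-suc 2 m (twoCars N a 0)) (∑-cong N (λ b 1≤b b≤N → completions-second a b 1≤a a≤N 1≤b b≤N))

  fiber-∑∑ : length (mvpFiber N (β m 2)) ≡ ∑ N (λ a → ∑ N (fiberAt N a))
  fiber-∑∑ = begin
    length (mvpFiber N (β m 2))                              ≡⟨ mvpFiber-completions ⟩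
    completions 1 N (replicate N nothing)                    ≡⟨ completions-suc 1 (suc m) _ ⟩
    ∑ N (λ a → completions? 2 (suc m) (enter 1 a (replicate N nothing)))
      ≡⟨ ∑-cong N (λ a 1≤a a≤N → trans (cong (completions? 2 (suc m)) (enter-first N a 1≤a a≤N)) (completions-first a 1≤a a≤N)) ⟩
    ∑ N (λ a → ∑ N (fiberAt N a))                            ∎
    where open ≡-Reasoning

-- Evaluating the double sum

fiberSum : ℕ → ℕ
fiberSum L = ∑ L (λ a → ∑ L (fiberAt L a))

fiberSum-suc : ∀ L → fiberSum (suc L) ≡ fiberAt (suc L) 1 1 + L + fiberSum L
fiberSum-suc L = begin
  fiberSum (suc L)
    ≡⟨ ∑∑-peel L (fiberAt (suc L)) ⟩
  -- the last block is fiberSum L because fiberAt (suc L) (suc a) (suc b) reduces to fiberAt L a b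
  fiberAt (suc L) 1 1 + ∑ L (λ b → fiberAt (suc L) 1 (suc b) + fiberAt (suc L) (suc b) 1) + fiberSum L
    ≡⟨ cong (λ x → fiberAt (suc L) 1 1 + x + fiberSum L) (trans (∑-cong L exactlyOne) (trans (∑-const L 1) (*-identityʳ L))) ⟩
  fiberAt (suc L) 1 1 + L + fiberSum L
    ∎
  where
  open ≡-Reasoning
  exactlyOne : ∀ b → 1 ≤ b → b ≤ L → fiberAt (suc L) 1 (suc b) + fiberAt (suc L) (suc b) 1 ≡ 1
  exactlyOne (suc b) _ _ = isEven+isOdd (L ∸ suc b)

fiberSum-step : ∀ k → fiberSum (3 + k) ≡ fiberSum (1 + k) + (2 * k + 4)
fiberSum-step k = begin
  fiberSum (3 + k)
    ≡⟨ fiberSum-suc (2 + k) ⟩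
  isEven k + (2 + k) + fiberSum (2 + k)
    ≡⟨ cong (isEven k + (2 + k) +_) (fiberSum-suc (1 + k)) ⟩
  isEven k + (2 + k) + (isOdd k + (1 + k) + fiberSum (1 + k))
    ≡⟨ regroup (isEven k) (isOdd k) k (fiberSum (1 + k)) ⟩
  fiberSum (1 + k) + (2 * k + 3 + (isEven k + isOdd k))
    ≡⟨ cong (λ x → fiberSum (1 + k) + (2 * k + 3 + x)) (isEven+isOdd k) ⟩
  fiberSum (1 + k) + (2 * k + 3 + 1)
    ≡⟨ cong (fiberSum (1 + k) +_) (+-assoc (2 * k) 3 1) ⟩
  fiberSum (1 + k) + (2 * k + 4)
    ∎
  where
  open ≡-Reasoning
  regroup : ∀ e o k s → e + (2 + k) + (o + (1 + k) + s) ≡ s + (2 * k + 3 + (e + o))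
  regroup = solve-∀

halfSquare-step : ∀ m → ((2 + m + 1) * (2 + m + 1)) / 2 ≡ ((m + 1) * (m + 1)) / 2 + (2 * m + 4)
halfSquare-step m = begin
  ((2 + m + 1) * (2 + m + 1)) / 2              ≡⟨ cong (_/ 2) (expand m) ⟩
  ((m + 1) * (m + 1) + (2 * m + 4) * 2) / 2    ≡⟨ +-distrib-/-∣ʳ ((m + 1) * (m + 1)) (divides (2 * m + 4) refl) ⟩
  ((m + 1) * (m + 1)) / 2 + ((2 * m + 4) * 2) / 2 ≡⟨ cong (((m + 1) * (m + 1)) / 2 +_) (m*n/n≡m (2 * m + 4) 2) ⟩
  ((m + 1) * (m + 1)) / 2 + (2 * m + 4)        ∎
  where
  open ≡-Reasoning
  expand : ∀ m → (2 + m + 1) * (2 + m + 1) ≡ (m + 1) * (m + 1) + (2 * m + 4) * 2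
  expand = solve-∀

fiberSum-closedForm : ∀ m → fiberSum (2 + m) ≡ m + 1 + ((m + 1) * (m + 1)) / 2
fiberSum-closedForm zero          = refl
fiberSum-closedForm (suc zero)    = refl
fiberSum-closedForm (suc (suc m)) = begin
  fiberSum (4 + m)                                         ≡⟨ fiberSum-step (suc m) ⟩
  fiberSum (2 + m) + (2 * suc m + 4)                       ≡⟨ cong (_+ (2 * suc m + 4)) (fiberSum-closedForm m) ⟩
  m + 1 + h + (2 * suc m + 4)                              ≡⟨ regroup m h ⟩
  2 + m + 1 + (h + (2 * m + 4))                            ≡⟨ cong (2 + m + 1 +_) (halfSquare-step m) ⟨
  2 + m + 1 + ((2 + m + 1) * (2 + m + 1)) / 2              ∎
  where
  open ≡-Reasoning
  h = ((m + 1) * (m + 1)) / 2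
  regroup : ∀ m h → m + 1 + h + (2 * suc m + 4) ≡ 2 + m + 1 + (h + (2 * m + 4))
  regroup = solve-∀

theorem4p2 : (m : ℕ) → length (mvpFiber (m + 2) (β m 2)) ≡ m + 1 + ((m + 1) * (m + 1)) / 2
theorem4p2 m rewrite +-comm m 2 = trans (FiberOfβ.fiber-∑∑ m) (fiberSum-closedForm m)
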